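{- Let $(\mathcal{P},\mathcal{L})$ be a partial geometry of order $(s,t,\alpha)$ and let $\mathrm{wt}:\mathcal{P}\to\mathbb{R}$ satisfy $\sum_{p\in\mathcal{P}}\mathrm{wt}(p)=0$. For a line $\ell$ put $\mathrm{wt}(\ell)=\sum_{p\in\ell}\mathrm{wt}(p)$. Then for every line $\ell\in\mathcal{L}$, $$(t-\alpha)\,\mathrm{wt}(\ell) = \sum_{m\sim \ell}\mathrm{wt}(m),$$ where the sum runs over all lines $m\neq\ell$ that share a point with $\ell$.
   Context: A partial geometry of order $(s,t,\alpha)$ is an incidence structure $(\mathcal{P},\mathcal{L})$ of points and lines (each line a set of points) such that: every point lies on exactly $t+1$ lines; every line contains exactly $s+1$ points; for every point $p$ and line $\ell$ with $p\notin\ell$, exactly $\alpha$ lines contain $p$ and meet $\ell$; and any two distinct points lie on at most one common line. -}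

module Defs where

open import Level using (Level)
open import Data.Nat using (ℕ; zero; suc)
open import Data.Bool using (Bool; true; false; _∧_; _∨_; not; if_then_else_)
open import Data.Fin using (Fin; zero; suc; _≟_)
open import Relation.Nullary using (does; ¬_)
open import Relation.Binary.PropositionalEquality using (_≡_)
open import Algebra.Bundles using (CommutativeRing)

count : ∀ {n} → (Fin n → Bool) → ℕ
count {zero} f = 0
count {suc n} f = (if f zero then 1 else 0) Data.Nat.+ count (λ i → f (suc i))

anyF : ∀ {n} → (Fin n → Bool) → Bool
anyF {zero} f = false
anyF {suc n} f = f zero ∨ anyF (λ i → f (suc i))

record PartialGeometry (s t α : ℕ) : Set where
  field
    v b : ℕ
    I : Fin v → Fin b → Bool
  meets : Fin b → Fin b → Bool
  meets m ℓ = anyF (λ q → I q m ∧ I q ℓ)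
  field
    -- lines are sets of points: distinct lines have distinct point sets
    lineExt : ∀ ℓ m → (∀ p → I p ℓ ≡ I p m) → ℓ ≡ m
    pointDeg : ∀ p → count (λ ℓ → I p ℓ) ≡ suc t
    lineSize : ∀ ℓ → count (λ p → I p ℓ) ≡ suc s
    alphaAx : ∀ p ℓ → I p ℓ ≡ false → count (λ m → I p m ∧ meets m ℓ) ≡ α
    atMostOne : ∀ p q ℓ m → ¬ (p ≡ q) → I p ℓ ≡ true → I q ℓ ≡ true
                → I p m ≡ true → I q m ≡ true → ℓ ≡ m

module RingSums {c ℓ : Level} (R : CommutativeRing c ℓ) where
  open CommutativeRing R using (Carrier; 0#; 1#; _+_)

  ∑ : ∀ {n} → (Fin n → Carrier) → Carrier
  ∑ {zero} f = 0#
  ∑ {suc n} f = f zero + ∑ (λ i → f (suc i))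

  ∑[_] : ∀ {n} → (Fin n → Bool) → (Fin n → Carrier) → Carrier
  ∑[ P ] f = ∑ (λ i → if P i then f i else 0#)

  ι : ℕ → Carrier
  ι zero = 0#
  ι (suc n) = 1# + ι n

  module _ {s t α : ℕ} (G : PartialGeometry s t α) (wt : Fin (PartialGeometry.v G) → Carrier) where
    open PartialGeometry G
    wtLine : Fin b → Carrier
    wtLine l = ∑[ (λ p → I p l) ] wt

    adj : Fin b → Fin b → Bool
    adj l m = not (does (m ≟ l)) ∧ meets m l

-- Double counting the incidences between points p and lines m adjacent to ℓ gives
--   Σ_{m ∼ ℓ} wt(m) = Σ_p N(p) wt(p),
-- where N(p) is the number of lines through p adjacent to ℓ. If p ∈ ℓ these are
-- the t lines through p other than ℓ; if p ∉ ℓ they are the α lines through p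
-- meeting ℓ, none of which is ℓ itself. Hence the sum equals
-- α Σ_p wt(p) + (t − α) wt(ℓ), and the first term vanishes.
module Submission where

open import Defs
open import Level using (Level)
open import Data.Nat as ℕ using (ℕ; zero; suc)
import Data.Nat.Properties as ℕ
open import Data.Fin using (Fin; zero; suc; _≟_)
open import Data.Bool using (Bool; true; false; _∧_; not; if_then_else_)
open import Data.Bool.Properties using (∧-comm; ∧-zeroʳ; ∧-identityʳ; if-float)
open import Relation.Nullary using (does; yes; no)
open import Relation.Binary.PropositionalEquality as ≡ using (_≡_; module ≡-Reasoning)
open import Algebra.Bundles using (CommutativeRing)
import Algebra.Properties.AbelianGroup as AbelianGroupProperties
import Algebra.Properties.CommutativeSemigroup as CommutativeSemigroupProperties
import Algebra.Properties.Ring as RingProperties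
import Algebra.Properties.Semiring.Sum as SemiringSum
import Relation.Binary.Reasoning.Setoid as SetoidReasoning

count-cong : ∀ {n} {f g : Fin n → Bool} → (∀ i → f i ≡ g i) → count f ≡ count g
count-cong {zero}  f≗g = ≡.refl
count-cong {suc n} f≗g =
  ≡.cong₂ (λ x k → (if x then 1 else 0) ℕ.+ k) (f≗g zero) (count-cong (λ i → f≗g (suc i)))

count-remove : ∀ {n} (f : Fin n → Bool) (l : Fin n) →
               count f ≡ (if f l then 1 else 0) ℕ.+ count (λ m → not (does (m ≟ l)) ∧ f m)
count-remove f zero    = ≡.refl
count-remove f (suc l) = begin
  f₀ ℕ.+ count (λ i → f (suc i))  ≡⟨ ≡.cong (f₀ ℕ.+_) (count-remove (λ i → f (suc i)) l) ⟩
  f₀ ℕ.+ (fₗ ℕ.+ rest)            ≡⟨ x∙yz≈y∙xz f₀ fₗ rest ⟩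
  fₗ ℕ.+ (f₀ ℕ.+ rest)            ∎
  where
  open ≡-Reasoning
  open CommutativeSemigroupProperties ℕ.+-commutativeSemigroup using (x∙yz≈y∙xz)
  f₀ = if f zero then 1 else 0
  fₗ = if f (suc l) then 1 else 0
  rest = count (λ m → not (does (m ≟ l)) ∧ f (suc m))

anyF-intro : ∀ {n} (f : Fin n → Bool) q → f q ≡ true → anyF f ≡ true
anyF-intro f zero    fq≡true rewrite fq≡true = ≡.refl
anyF-intro f (suc q) fq≡true with f zero
... | true  = ≡.refl
... | false = anyF-intro (λ i → f (suc i)) q fq≡true

module _ {s t α : ℕ} (G : PartialGeometry s t α) where
  open PartialGeometry G

  -- Definitionally RingSums.adj, which takes an irrelevant weight argument.
  adjacent : Fin b → Fin b → Bool
  adjacent l m = not (does (m ≟ l)) ∧ meets m l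

  count-adjacent-through-on : ∀ {p l} → I p l ≡ true →
                              count (λ m → adjacent l m ∧ I p m) ≡ t
  count-adjacent-through-on {p} {l} p∈l = ℕ.suc-injective (begin
    suc (count (λ m → adjacent l m ∧ I p m))  ≡⟨ ≡.cong suc (count-cong other-lines-through-p) ⟩
    suc others                                ≡⟨ ≡.cong (λ x → (if x then 1 else 0) ℕ.+ others) p∈l ⟨
    (if I p l then 1 else 0) ℕ.+ others       ≡⟨ count-remove (λ m → I p m) l ⟨
    count (λ m → I p m)                       ≡⟨ pointDeg p ⟩
    suc t                                     ∎)
    where
    open ≡-Reasoning
    others = count (λ m → not (does (m ≟ l)) ∧ I p m)
    other-lines-through-p : ∀ m → adjacent l m ∧ I p m ≡ not (does (m ≟ l)) ∧ I p m
    other-lines-through-p m with I p m in p∈m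
    ... | false = ≡.trans (∧-zeroʳ _) (≡.sym (∧-zeroʳ _))
    ... | true rewrite anyF-intro (λ q → I q m ∧ I q l) p (≡.cong₂ _∧_ p∈m p∈l) = ∧-identityʳ _

  count-adjacent-through-off : ∀ {p l} → I p l ≡ false →
                               count (λ m → adjacent l m ∧ I p m) ≡ α
  count-adjacent-through-off {p} {l} p∉l =
    ≡.trans (count-cong lines-through-p-meeting-l) (alphaAx p l p∉l)
    where
    lines-through-p-meeting-l : ∀ m → adjacent l m ∧ I p m ≡ I p m ∧ meets m l
    lines-through-p-meeting-l m with m ≟ l
    ... | yes ≡.refl rewrite p∉l = ≡.refl
    ... | no _ = ∧-comm (meets m l) (I p m)

  count-adjacent-through : ∀ p l → count (λ m → adjacent l m ∧ I p m) ≡ (if I p l then t else α)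
  count-adjacent-through p l with I p l in p∈l
  ... | true  = count-adjacent-through-on p∈l
  ... | false = count-adjacent-through-off p∈l

module _ {c ℓ′ : Level} (R : CommutativeRing c ℓ′) where
  open CommutativeRing R hiding (zero)
  open RingSums R
  open SemiringSum semiring using (sum; sum-cong-≋; sum-replicate-zero; ∑-comm; ∑-distrib-+; *-distribˡ-sum)
  open SetoidReasoning setoid
  open AbelianGroupProperties +-abelianGroup using (xyx⁻¹≈y)
  open RingProperties ring using ([y-z]x≈yx-zx)

  ∑≡sum : ∀ {n} (f : Fin n → Carrier) → ∑ f ≡ sum f
  ∑≡sum {zero}  f = ≡.refl
  ∑≡sum {suc n} f = ≡.cong (f zero +_) (∑≡sum (λ i → f (suc i)))

  sum-indicator : ∀ {n} (P : Fin n → Bool) x → sum (λ i → if P i then x else 0#) ≈ ι (count P) * x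
  sum-indicator {zero}  P x = sym (zeroˡ x)
  sum-indicator {suc n} P x with P zero
  ... | true  = trans (+-congˡ (sum-indicator (λ i → P (suc i)) x))
                      (sym (trans (distribʳ x 1# _) (+-congʳ (*-identityˡ x))))
  ... | false = trans (+-identityˡ _) (sum-indicator (λ i → P (suc i)) x)

  sum-double-count : ∀ {m n} (A : Fin n → Bool) (J : Fin m → Fin n → Bool) (f : Fin m → Carrier) →
                     sum (λ j → if A j then sum (λ i → if J i j then f i else 0#) else 0#)
                     ≈ sum (λ i → ι (count (λ j → A j ∧ J i j)) * f i)
  sum-double-count {m} A J f = begin
    sum (λ j → if A j then sum (λ i → if J i j then f i else 0#) else 0#)  ≈⟨ sum-cong-≋ restrict ⟩
    sum (λ j → sum (λ i → if A j ∧ J i j then f i else 0#))               ≈⟨ ∑-comm (λ j i → if A j ∧ J i j then f i else 0#) ⟩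
    sum (λ i → sum (λ j → if A j ∧ J i j then f i else 0#))               ≈⟨ sum-cong-≋ (λ i → sum-indicator (λ j → A j ∧ J i j) (f i)) ⟩
    sum (λ i → ι (count (λ j → A j ∧ J i j)) * f i)                      ∎
    where
    restrict : ∀ j → (if A j then sum (λ i → if J i j then f i else 0#) else 0#)
                     ≈ sum (λ i → if A j ∧ J i j then f i else 0#)
    restrict j with A j
    ... | true  = refl
    ... | false = sym (sum-replicate-zero m)

  sum-two-valued : ∀ {n} (Q : Fin n → Bool) a b (f : Fin n → Carrier) →
                   sum (λ i → (if Q i then a else b) * f i)
                   ≈ b * sum f + (a - b) * sum (λ i → if Q i then f i else 0#)
  sum-two-valued Q a b f = begin
    sum (λ i → (if Q i then a else b) * f i)            ≈⟨ sum-cong-≋ split ⟩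
    sum (λ i → b * f i + (a - b) * χ i)                 ≈⟨ ∑-distrib-+ (λ i → b * f i) (λ i → (a - b) * χ i) ⟩
    sum (λ i → b * f i) + sum (λ i → (a - b) * χ i)    ≈⟨ +-cong (*-distribˡ-sum b f) (*-distribˡ-sum (a - b) χ) ⟨
    b * sum f + (a - b) * sum χ                         ∎
    where
    χ : Fin _ → Carrier
    χ i = if Q i then f i else 0#
    split : ∀ i → (if Q i then a else b) * f i ≈ b * f i + (a - b) * χ i
    split i with Q i
    ... | true  = sym (begin
      b * f i + (a - b) * f i        ≈⟨ +-congˡ ([y-z]x≈yx-zx (f i) a b) ⟩
      b * f i + (a * f i - b * f i)  ≈⟨ +-assoc _ _ _ ⟨
      b * f i + a * f i - b * f i    ≈⟨ xyx⁻¹≈y (b * f i) (a * f i) ⟩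
      a * f i                        ∎)
    ... | false = sym (trans (+-congˡ (zeroʳ (a - b))) (+-identityʳ (b * f i)))

lemma1 : ∀ {c ℓ′ : Level} (R : CommutativeRing c ℓ′) {s t α : ℕ}
           (G : PartialGeometry s t α)
           (wt : Fin (PartialGeometry.v G) → CommutativeRing.Carrier R) →
           CommutativeRing._≈_ R (RingSums.∑ R wt) (CommutativeRing.0# R) →
           (l : Fin (PartialGeometry.b G)) →
           CommutativeRing._≈_ R
             (CommutativeRing._*_ R
               (CommutativeRing._-_ R (RingSums.ι R t) (RingSums.ι R α))
               (RingSums.wtLine R G wt l))
             (RingSums.∑[_] R (RingSums.adj R G wt l) (RingSums.wtLine R G wt))
lemma1 R {t = t} {α} G wt ∑wt≈0 l = begin
  (ι t - ι α) * wtLine G wt l                                      ≡⟨ ≡.cong ((ι t - ι α) *_) (∑≡sum R wtₗ) ⟩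
  (ι t - ι α) * sum wtₗ                                            ≈⟨ drop-total-weight ⟨
  ι α * sum wt + (ι t - ι α) * sum wtₗ                             ≈⟨ sum-two-valued R (λ p → I p l) (ι t) (ι α) wt ⟨
  sum (λ p → (if I p l then ι t else ι α) * wt p)                  ≡⟨ sum-cong-≗ lines-through-p ⟨
  sum (λ p → ι (count (λ m → adjacent G l m ∧ I p m)) * wt p)      ≈⟨ sum-double-count R (adjacent G l) I wt ⟨
  sum (λ m → if adjacent G l m then sum (λ p → if I p m then wt p else 0#) else 0#)
                                                                   ≡⟨ ∑[adj]≡sum ⟨
  ∑[ adj G wt l ] (wtLine G wt)                                    ∎
  where
  open CommutativeRing R
  open RingSums R
  open PartialGeometry G
  open SemiringSum semiring using (sum; sum-cong-≗)
  open SetoidReasoning setoid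
  wtₗ : Fin v → Carrier
  wtₗ p = if I p l then wt p else 0#
  drop-total-weight : ι α * sum wt + (ι t - ι α) * sum wtₗ ≈ (ι t - ι α) * sum wtₗ
  drop-total-weight = begin
    ι α * sum wt + (ι t - ι α) * sum wtₗ  ≡⟨ ≡.cong (λ x → ι α * x + (ι t - ι α) * sum wtₗ) (∑≡sum R wt) ⟨
    ι α * ∑ wt + (ι t - ι α) * sum wtₗ    ≈⟨ +-congʳ (trans (*-congˡ ∑wt≈0) (zeroʳ (ι α))) ⟩
    0# + (ι t - ι α) * sum wtₗ            ≈⟨ +-identityˡ _ ⟩
    (ι t - ι α) * sum wtₗ                 ∎
  lines-through-p : ∀ p → ι (count (λ m → adjacent G l m ∧ I p m)) * wt p
                          ≡ (if I p l then ι t else ι α) * wt p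
  lines-through-p p =
    ≡.cong (_* wt p) (≡.trans (≡.cong ι (count-adjacent-through G p l)) (if-float ι (I p l)))
  ∑[adj]≡sum : ∑[ adj G wt l ] (wtLine G wt)
               ≡ sum (λ m → if adjacent G l m then sum (λ p → if I p m then wt p else 0#) else 0#)
  ∑[adj]≡sum = ≡.trans (∑≡sum R (λ m → if adjacent G l m then wtLine G wt m else 0#))
                       (sum-cong-≗ (λ m → ≡.cong (λ x → if adjacent G l m then x else 0#)
                                                 (∑≡sum R (λ p → if I p m then wt p else 0#))))
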